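{- Let $\sigma,\tau\in\mathfrak{S}_n$. Then $$\langle 0|\,\mathtt{a}_{\sigma(n)}\cdots\mathtt{a}_{\sigma(1)}\,\mathtt{a}_{\tau(1)}^{\dag}\cdots\mathtt{a}_{\tau(n)}^{\dag}\,|0\rangle = \mathrm{v}_n(C_\sigma,C_\tau) = \prod_{\substack{1\le i<j\le n\\ \tau^{ -1}\sigma(i)>\tau^{ -1}\sigma(j)}} q_{\sigma(i),\sigma(j)}.$$
   Context: The operators $\mathtt{a}_i,\mathtt{a}_i^{\dag}$ satisfy $\mathtt{a}_i\mathtt{a}_j^{\dag} = q_{i,j}\mathtt{a}_j^{\dag}\mathtt{a}_i+\delta_{i,j}$ with $q_{i,j}$ commuting variables, act on a module with vacuum $|0\rangle$ such that $\mathtt{a}_i|0\rangle=0$, $\langle 0|\mathtt{a}_i^{\dag}=0$, $\langle 0|0\rangle = 1$. $C_\sigma=\{x\in\mathbb{R}^n\mid x_{\sigma(1)}<\dots<x_{\sigma(n)}\}$ is the chamber of the braid arrangement associated to $\sigma$, and $\mathrm{v}_n$ is the Aguiar–Mahajan bilinear form with variable $q_{i,j}$ assigned to the half-space $\{x_i<x_j\}$, given explicitly by the displayed product. -}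

module Defs where

open import Level using (Level; _⊔_)
open import Data.Nat using (ℕ; zero; suc)
open import Data.Fin using (Fin; zero; suc; _<_; _>_)
open import Data.Fin.Properties using (_≟_; _<?_)
open import Data.Fin.Permutation using (Permutation′; _⟨$⟩ʳ_; _⟨$⟩ˡ_)
open import Data.List using (List; foldr; foldl; allFin)
open import Data.Bool using (if_then_else_; _∧_)
open import Relation.Nullary.Decidable using (⌊_⌋)
open import Algebra.Bundles using (CommutativeRing)
open import Algebra.Module.Bundles using (Module)

module _ {c ℓ} (R : CommutativeRing c ℓ) where
  open CommutativeRing R using (Carrier; _*_; 1#)

  ∏ : ∀ {n} → (Fin n → Carrier) → Carrier
  ∏ {zero}  f = 1#
  ∏ {suc n} f = f zero * ∏ (λ k → f (suc k))

-- A representation of the q-deformed oscillator relations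
--   a_i a_j^† = q_{i,j} a_j^† a_i + δ_{i,j}
-- on a module M over a commutative ring R (containing the commuting
-- parameters q_{i,j}), together with a vacuum |0⟩ ∈ M and the vacuum
-- covector ⟨0| : M → R.
module _ {c ℓ m ℓm} (R : CommutativeRing c ℓ) (M : Module R m ℓm) where
  open CommutativeRing R using (Carrier; _≈_; _+_; _*_; 0#; 1#)
  open Module M

  record OscRep (n : ℕ) (q : Fin n → Fin n → Carrier) : Set (c ⊔ ℓ ⊔ m ⊔ ℓm) where
    field
      a    : Fin n → Carrierᴹ → Carrierᴹ
      a†   : Fin n → Carrierᴹ → Carrierᴹ
      vac  : Carrierᴹ
      bra  : Carrierᴹ → Carrier
      a-cong   : ∀ i {x y} → x ≈ᴹ y → a i x ≈ᴹ a i y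
      a-+      : ∀ i x y → a i (x +ᴹ y) ≈ᴹ a i x +ᴹ a i y
      a-*      : ∀ i r x → a i (r *ₗ x) ≈ᴹ r *ₗ a i x
      a†-cong  : ∀ i {x y} → x ≈ᴹ y → a† i x ≈ᴹ a† i y
      a†-+     : ∀ i x y → a† i (x +ᴹ y) ≈ᴹ a† i x +ᴹ a† i y
      a†-*     : ∀ i r x → a† i (r *ₗ x) ≈ᴹ r *ₗ a† i x
      bra-cong : ∀ {x y} → x ≈ᴹ y → bra x ≈ bra y
      bra-+    : ∀ x y → bra (x +ᴹ y) ≈ bra x + bra y
      bra-*    : ∀ r x → bra (r *ₗ x) ≈ r * bra x
      comm : ∀ i j x →
        a i (a† j x) ≈ᴹ (q i j *ₗ a† j (a i x)) +ᴹ (if ⌊ i ≟ j ⌋ then x else 0ᴹ)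
      a-vac   : ∀ i → a i vac ≈ᴹ 0ᴹ
      bra-a†  : ∀ i x → bra (a† i x) ≈ 0#
      bra-vac : bra vac ≈ 1#

    vev : Permutation′ n → Permutation′ n → Carrier
    vev σ τ = bra (foldl (λ x k → a (σ ⟨$⟩ʳ k) x)
                         (foldr (λ k x → a† (τ ⟨$⟩ʳ k) x) vac (allFin n))
                         (allFin n))

-- Aguiar–Mahajan form v_n(C_σ, C_τ): product, over the hyperplanes
-- x_a = x_b separating the chambers C_σ and C_τ, of the variable of the
-- half-space containing C_σ.  C_σ ⊆ {x_a < x_b} iff σ⁻¹(a) < σ⁻¹(b), whose
-- variable is q_{a,b}; the hyperplane separates iff moreover τ⁻¹(a) > τ⁻¹(b).
module _ {c ℓ} (R : CommutativeRing c ℓ) where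
  open CommutativeRing R using (Carrier; 1#)

  vₙ : ∀ {n} → (Fin n → Fin n → Carrier) → Permutation′ n → Permutation′ n → Carrier
  vₙ q σ τ = ∏ R λ a → ∏ R λ b →
    if ⌊ (σ ⟨$⟩ˡ a) <? (σ ⟨$⟩ˡ b) ⌋ ∧ ⌊ (τ ⟨$⟩ˡ b) <? (τ ⟨$⟩ˡ a) ⌋
    then q a b else 1#

  rhsProd : ∀ {n} → (Fin n → Fin n → Carrier) → Permutation′ n → Permutation′ n → Carrier
  rhsProd q σ τ = ∏ R λ i → ∏ R λ j →
    if ⌊ i <? j ⌋ ∧ ⌊ (τ ⟨$⟩ˡ (σ ⟨$⟩ʳ j)) <? (τ ⟨$⟩ˡ (σ ⟨$⟩ʳ i)) ⌋
    then q (σ ⟨$⟩ʳ i) (σ ⟨$⟩ʳ j) else 1#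

-- Move the annihilators through the creation word one at a time.  By the
-- relation a_i a†_j = q_{i,j} a†_j a_i + δ_{i,j} and a_i |0⟩ = 0, a_i kills a
-- word of creators that does not contain a†_i, and on a word with distinct
-- labels containing a†_i it deletes that creator, collecting q_{i,j} for every
-- a†_j to its left.  With the word a†_{τ(1)} ⋯ a†_{τ(n)} and the annihilators
-- applied in the order σ(1), σ(2), …, step i therefore contributes
-- q_{σ(i),σ(j)} for each later j whose creator stands to the left, i.e. for
-- each inversion i < j, τ⁻¹σ(i) > τ⁻¹σ(j).  Reindexing the pairs of
-- coordinates of vₙ through σ gives the same product.

module Submission where

open import Defs
open import Data.Nat using (ℕ)
open import Data.Fin using (Fin)
open import Data.Fin.Permutation using (Permutation′)
open import Data.Product using (_×_)
open import Algebra.Bundles using (CommutativeRing)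
open import Algebra.Module.Bundles using (Module)

open import Data.Nat as ℕ using (zero; suc; _+_; _≤?_)
open import Data.Nat.Properties
  using (≤-refl; <⇒≤; <⇒≱; ≤∧≢⇒<; <-irrefl; +-identityʳ; +-suc)
open import Data.Fin using (zero; suc; toℕ)
open import Data.Fin.Properties
  using (_≟_; _<?_; 0≢1+n; toℕ<n; toℕ-injective; suc-injective)
open import Data.Fin.Permutation using (_⟨$⟩ʳ_; _⟨$⟩ˡ_; inverseʳ; inverseˡ; flip; _∘ₚ_)
open import Data.List using (List; []; _∷_; foldr; foldl; tabulate; allFin)
open import Data.Bool using (Bool; true; false; if_then_else_; _∧_)
open import Data.Bool.Properties using (∧-zeroʳ)
open import Data.Product using (_,_)
open import Function using (_∘_; mk⇔; Injective; Injection)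
open import Function.Properties.Inverse using (↔⇒↣)
open import Relation.Nullary using (Dec; does; ¬_)
open import Relation.Nullary.Decidable using (⌊_⌋; isYes≗does; dec-true; dec-false; does-⇔)
open import Relation.Binary.PropositionalEquality as ≡
  using (_≡_; _≢_; refl; cong; _≗_; module ≡-Reasoning)
import Relation.Binary.Reasoning.Setoid as SetoidReasoning
import Algebra.Properties.CommutativeMonoid.Sum as CommutativeMonoidSum

⌊⌋-true : ∀ {a} {A : Set a} (a? : Dec A) → A → ⌊ a? ⌋ ≡ true
⌊⌋-true a? a = ≡.trans (isYes≗does a?) (dec-true a? a)

⌊⌋-false : ∀ {a} {A : Set a} (a? : Dec A) → ¬ A → ⌊ a? ⌋ ≡ false
⌊⌋-false a? ¬a = ≡.trans (isYes≗does a?) (dec-false a? ¬a)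

does-suc≤? : ∀ {r x} → x ≢ r → does (suc r ≤? x) ≡ does (r ≤? x)
does-suc≤? {r} {x} x≢r =
  does-⇔ (mk⇔ <⇒≤ (λ r≤x → ≤∧≢⇒< r≤x (x≢r ∘ ≡.sym))) (suc r ≤? x) (r ≤? x)

∧-congʳ-true : ∀ {b b′ c : Bool} → (c ≡ true → b ≡ b′) → b ∧ c ≡ b′ ∧ c
∧-congʳ-true {b} {b′} {false} _ = ≡.trans (∧-zeroʳ b) (≡.sym (∧-zeroʳ b′))
∧-congʳ-true {c = true} b≡b′ = cong (_∧ true) (b≡b′ refl)

does-≤?∧<?≡⌊<?⌋∧⌊<?⌋ : ∀ {k k′} (r j : Fin k) (x y : Fin k′) → (r ≡ j → x ≡ y) →
  does (toℕ r ≤? toℕ j) ∧ does (y <? x) ≡ ⌊ r <? j ⌋ ∧ ⌊ y <? x ⌋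
does-≤?∧<?≡⌊<?⌋∧⌊<?⌋ r j x y r≡j⇒x≡y = begin
  does (toℕ r ≤? toℕ j) ∧ does (y <? x)
    ≡⟨ ∧-congʳ-true (λ y<x → ≡.sym (does-suc≤? (j≢r y<x ∘ toℕ-injective))) ⟩
  does (r <? j) ∧ does (y <? x)
    ≡⟨ ≡.cong₂ _∧_ (isYes≗does (r <? j)) (isYes≗does (y <? x)) ⟨
  ⌊ r <? j ⌋ ∧ ⌊ y <? x ⌋
    ∎
  where
  open ≡-Reasoning
  j≢r : does (y <? x) ≡ true → j ≢ r
  j≢r y<x refl with () ← ≡.trans (≡.sym y<x)
    (≡.trans (cong (λ z → does (y <? z)) (r≡j⇒x≡y refl)) (dec-false (y <? y) (<-irrefl refl)))

module Products {c ℓ} (R : CommutativeRing c ℓ) where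
  open CommutativeRing R
    using (Carrier; _≈_; _*_; 1#; setoid; reflexive; trans; *-commutativeMonoid)
  open CommutativeMonoidSum *-commutativeMonoid
    using (sum; sum-cong-≋; sum-permute; sum-replicate-zero)

  ∏≡sum : ∀ {k} (f : Fin k → Carrier) → ∏ R f ≡ sum f
  ∏≡sum {zero}  f = refl
  ∏≡sum {suc k} f = cong (f zero *_) (∏≡sum (f ∘ suc))

  ∏-cong : ∀ {k} {f g : Fin k → Carrier} → (∀ i → f i ≈ g i) → ∏ R f ≈ ∏ R g
  ∏-cong {f = f} {g} f≈g = begin
    ∏ R f ≡⟨ ∏≡sum f ⟩
    sum f ≈⟨ sum-cong-≋ f≈g ⟩
    sum g ≡⟨ ∏≡sum g ⟨
    ∏ R g ∎
    where open SetoidReasoning setoid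

  ∏-permute : ∀ {k} (f : Fin k → Carrier) (π : Permutation′ k) →
    ∏ R f ≈ ∏ R (f ∘ (π ⟨$⟩ʳ_))
  ∏-permute f π = begin
    ∏ R f                 ≡⟨ ∏≡sum f ⟩
    sum f                 ≈⟨ sum-permute f π ⟩
    sum (f ∘ (π ⟨$⟩ʳ_))   ≡⟨ ∏≡sum (f ∘ (π ⟨$⟩ʳ_)) ⟨
    ∏ R (f ∘ (π ⟨$⟩ʳ_))   ∎
    where open SetoidReasoning setoid

  ∏-one : ∀ {k} {f : Fin k → Carrier} → (∀ i → f i ≈ 1#) → ∏ R f ≈ 1#
  ∏-one {k} {f} f≈1 = begin
    ∏ R f                   ≈⟨ ∏-cong f≈1 ⟩
    ∏ R {k} (λ _ → 1#)      ≡⟨ ∏≡sum {k} (λ _ → 1#) ⟩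
    sum {k} (λ _ → 1#)      ≈⟨ sum-replicate-zero k ⟩
    1#                      ∎
    where open SetoidReasoning setoid

  inversionProduct : ∀ {k} → (Fin k → Fin k → Carrier) → Permutation′ k → Carrier
  inversionProduct w π = ∏ R λ i → ∏ R λ j →
    if ⌊ i <? j ⌋ ∧ ⌊ π ⟨$⟩ʳ j <? π ⟨$⟩ʳ i ⌋ then w i j else 1#

  inversionProduct-cong : ∀ {k} {w w′ : Fin k → Fin k → Carrier} (π : Permutation′ k) →
    (∀ i j → w i j ≡ w′ i j) → inversionProduct w π ≈ inversionProduct w′ π
  inversionProduct-cong π w≡w′ =
    ∏-cong λ i → ∏-cong λ j → reflexive (cong (if _ then_else 1#) (w≡w′ i j))

  vₙ≈rhsProd : ∀ {n} (q : Fin n → Fin n → Carrier) (σ τ : Permutation′ n) →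
    vₙ R q σ τ ≈ rhsProd R q σ τ
  vₙ≈rhsProd q σ τ =
    trans (∏-permute _ σ) (∏-cong λ i → trans (∏-permute _ σ) (∏-cong λ j → reflexive (term i j)))
    where
    term : ∀ i j →
      (if ⌊ σ ⟨$⟩ˡ (σ ⟨$⟩ʳ i) <? σ ⟨$⟩ˡ (σ ⟨$⟩ʳ j) ⌋ ∧ ⌊ τ ⟨$⟩ˡ (σ ⟨$⟩ʳ j) <? τ ⟨$⟩ˡ (σ ⟨$⟩ʳ i) ⌋
        then q (σ ⟨$⟩ʳ i) (σ ⟨$⟩ʳ j) else 1#)
      ≡ (if ⌊ i <? j ⌋ ∧ ⌊ τ ⟨$⟩ˡ (σ ⟨$⟩ʳ j) <? τ ⟨$⟩ˡ (σ ⟨$⟩ʳ i) ⌋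
        then q (σ ⟨$⟩ʳ i) (σ ⟨$⟩ʳ j) else 1#)
    term i j rewrite inverseˡ σ {i} | inverseˡ σ {j} = refl

module Fock {c ℓ m ℓm} {R : CommutativeRing c ℓ} {M : Module R m ℓm}
  {n : ℕ} {q : Fin n → Fin n → CommutativeRing.Carrier R} (rep : OscRep R M n q) where
  open CommutativeRing R using (Carrier; _≈_; _*_; 1#; 0#)
  open Module M
  open OscRep rep
  open Products R
  open SetoidReasoning ≈ᴹ-setoid

  a†-zero : ∀ j → a† j 0ᴹ ≈ᴹ 0ᴹ
  a†-zero j = begin
    a† j 0ᴹ          ≈⟨ a†-cong j (*ₗ-zeroˡ 0ᴹ) ⟨
    a† j (0# *ₗ 0ᴹ)  ≈⟨ a†-* j 0# 0ᴹ ⟩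
    0# *ₗ a† j 0ᴹ    ≈⟨ *ₗ-zeroˡ _ ⟩
    0ᴹ               ∎

  a-a†-≢ : ∀ {i j} → i ≢ j → ∀ x → a i (a† j x) ≈ᴹ q i j *ₗ a† j (a i x)
  a-a†-≢ {i} {j} i≢j x = begin
    a i (a† j x)
      ≈⟨ comm i j x ⟩
    q i j *ₗ a† j (a i x) +ᴹ (if ⌊ i ≟ j ⌋ then x else 0ᴹ)
      ≡⟨ cong (λ b → _ +ᴹ (if b then x else 0ᴹ)) (⌊⌋-false (i ≟ j) i≢j) ⟩
    q i j *ₗ a† j (a i x) +ᴹ 0ᴹ
      ≈⟨ +ᴹ-identityʳ _ ⟩
    q i j *ₗ a† j (a i x)
      ∎

  a-a†-≡ : ∀ i x → a i x ≈ᴹ 0ᴹ → a i (a† i x) ≈ᴹ x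
  a-a†-≡ i x aix≈0 = begin
    a i (a† i x)
      ≈⟨ comm i i x ⟩
    q i i *ₗ a† i (a i x) +ᴹ (if ⌊ i ≟ i ⌋ then x else 0ᴹ)
      ≡⟨ cong (λ b → _ +ᴹ (if b then x else 0ᴹ)) (⌊⌋-true (i ≟ i) refl) ⟩
    q i i *ₗ a† i (a i x) +ᴹ x
      ≈⟨ +ᴹ-congʳ (*ₗ-congˡ (≈ᴹ-trans (a†-cong i aix≈0) (a†-zero i))) ⟩
    q i i *ₗ 0ᴹ +ᴹ x
      ≈⟨ +ᴹ-congʳ (*ₗ-zeroʳ _) ⟩
    0ᴹ +ᴹ x
      ≈⟨ +ᴹ-identityˡ x ⟩
    x
      ∎

  a†^ : Bool → Fin n → Carrierᴹ → Carrierᴹ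
  a†^ true  j x = a† j x
  a†^ false j x = x

  -- The word a†_{t 0} ⋯ a†_{t (k-1)} |0⟩ with the creators outside the mask p
  -- deleted; keeping the positions fixed lets all products range over Fin k.
  create : ∀ {k} → (Fin k → Bool) → (Fin k → Fin n) → Carrierᴹ
  create {zero}  p t = vac
  create {suc k} p t = a†^ (p zero) (t zero) (create (p ∘ suc) (t ∘ suc))

  create-cong : ∀ {k} {p p′ : Fin k → Bool} (t : Fin k → Fin n) → p ≗ p′ →
    create p t ≡ create p′ t
  create-cong {zero}  t p≗p′ = refl
  create-cong {suc k} t p≗p′ =
    ≡.cong₂ (λ b → a†^ b (t zero)) (p≗p′ zero) (create-cong (t ∘ suc) (p≗p′ ∘ suc))

  create-none : ∀ {k} {p : Fin k → Bool} (t : Fin k → Fin n) → (∀ m → p m ≡ false) →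
    create p t ≡ vac
  create-none {zero}  t _ = refl
  create-none {suc k} {p} t p≡false with p zero | p≡false zero
  ... | false | refl = create-none (t ∘ suc) (p≡false ∘ suc)

  create-all : ∀ {j k} (t : Fin k → Fin n) (h : Fin j → Fin k) →
    foldr (λ r x → a† (t r) x) vac (tabulate h) ≡ create (λ _ → true) (t ∘ h)
  create-all {zero}  t h = refl
  create-all {suc j} t h = cong (a† (t (h zero))) (create-all t (h ∘ suc))

  a-create-absent : ∀ {k} (p : Fin k → Bool) (t : Fin k → Fin n) i →
    (∀ m → p m ≡ true → t m ≢ i) → a i (create p t) ≈ᴹ 0ᴹ
  a-create-absent {zero}  p t i _ = a-vac i
  a-create-absent {suc k} p t i absent with p zero in e
  ... | false = a-create-absent (p ∘ suc) (t ∘ suc) i (absent ∘ suc)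
  ... | true  = begin
    a i (a† (t zero) x)                  ≈⟨ a-a†-≢ (λ i≡t₀ → absent zero e (≡.sym i≡t₀)) x ⟩
    q i (t zero) *ₗ a† (t zero) (a i x)  ≈⟨ *ₗ-congˡ (a†-cong _ tail-killed) ⟩
    q i (t zero) *ₗ a† (t zero) 0ᴹ       ≈⟨ *ₗ-congˡ (a†-zero _) ⟩
    q i (t zero) *ₗ 0ᴹ                   ≈⟨ *ₗ-zeroʳ _ ⟩
    0ᴹ                                   ∎
    where
    x = create (p ∘ suc) (t ∘ suc)
    tail-killed = a-create-absent (p ∘ suc) (t ∘ suc) i (absent ∘ suc)

  -- Uses does rather than ⌊_⌋, so that weightBefore p t (suc s) unfolds
  -- definitionally to its head factor times weightBefore (p ∘ suc) (t ∘ suc) s.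
  weightBefore : ∀ {k} → (Fin k → Bool) → (Fin k → Fin n) → Fin k → Carrier
  weightBefore p t s = ∏ R λ m → if p m ∧ does (m <? s) then q (t s) (t m) else 1#

  weightBefore-zero : ∀ {k} (p : Fin (suc k) → Bool) t → weightBefore p t zero ≈ 1#
  weightBefore-zero p t =
    ∏-one λ m → reflexive (cong (if_then q (t zero) (t m) else 1#) (∧-zeroʳ (p m)))
    where open CommutativeRing R using (reflexive)

  a-create : ∀ {k} (p p′ : Fin k → Bool) (t : Fin k → Fin n) s →
    p s ≡ true → p′ s ≡ false → (∀ m → m ≢ s → p′ m ≡ p m) →
    (∀ m → p m ≡ true → t m ≡ t s → m ≡ s) →
    a (t s) (create p t) ≈ᴹ weightBefore p t s *ₗ create p′ t
  a-create {suc k} p p′ t zero ps p′s p′≡p unique = begin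
    a (t zero) (create p t)               ≡⟨ cong (λ b → a (t zero) (a†^ b (t zero) x)) ps ⟩
    a (t zero) (a† (t zero) x)            ≈⟨ a-a†-≡ (t zero) x tail-killed ⟩
    x                                     ≡⟨ create-cong (t ∘ suc) (λ m → p′≡p (suc m) λ ()) ⟨
    y                                     ≡⟨ cong (λ b → a†^ b (t zero) y) p′s ⟨
    create p′ t                           ≈⟨ *ₗ-identityˡ _ ⟨
    1# *ₗ create p′ t                     ≈⟨ *ₗ-congʳ (weightBefore-zero p t) ⟨
    weightBefore p t zero *ₗ create p′ t  ∎
    where
    x = create (p ∘ suc) (t ∘ suc)
    y = create (p′ ∘ suc) (t ∘ suc)
    tail-killed = a-create-absent (p ∘ suc) (t ∘ suc) (t zero)
      (λ m pm tm≡t₀ → 0≢1+n (≡.sym (unique (suc m) pm tm≡t₀)))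
  a-create {suc k} p p′ t (suc s) ps p′s p′≡p unique = past-head
    where
    x = create (p ∘ suc) (t ∘ suc)
    y = create (p′ ∘ suc) (t ∘ suc)
    w = weightBefore (p ∘ suc) (t ∘ suc) s

    in-tail : a (t (suc s)) x ≈ᴹ w *ₗ y
    in-tail = a-create (p ∘ suc) (p′ ∘ suc) (t ∘ suc) s ps p′s
      (λ m m≢s → p′≡p (suc m) (m≢s ∘ suc-injective))
      (λ m pm tm≡ts → suc-injective (unique (suc m) pm tm≡ts))

    head-kept : p′ zero ≡ p zero
    head-kept = p′≡p zero 0≢1+n

    past-head : a (t (suc s)) (create p t) ≈ᴹ weightBefore p t (suc s) *ₗ create p′ t
    past-head with p zero in e
    ... | false = begin
      a (t (suc s)) x          ≈⟨ in-tail ⟩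
      w *ₗ y                   ≈⟨ *ₗ-congʳ (*-identityˡ w) ⟨
      (1# * w) *ₗ y            ≡⟨ cong (λ b → (1# * w) *ₗ a†^ b (t zero) y) (≡.trans head-kept e) ⟨
      (1# * w) *ₗ create p′ t  ∎
      where open CommutativeRing R using (*-identityˡ)
    ... | true = begin
      a (t (suc s)) (a† (t zero) x)        ≈⟨ a-a†-≢ (λ ts≡t₀ → 0≢1+n (unique zero e (≡.sym ts≡t₀))) x ⟩
      q₀ *ₗ a† (t zero) (a (t (suc s)) x)  ≈⟨ *ₗ-congˡ (a†-cong _ in-tail) ⟩
      q₀ *ₗ a† (t zero) (w *ₗ y)           ≈⟨ *ₗ-congˡ (a†-* _ w y) ⟩
      q₀ *ₗ (w *ₗ a† (t zero) y)           ≈⟨ *ₗ-assoc q₀ w _ ⟨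
      (q₀ * w) *ₗ a† (t zero) y            ≡⟨ cong (λ b → (q₀ * w) *ₗ a†^ b (t zero) y) (≡.trans head-kept e) ⟨
      (q₀ * w) *ₗ create p′ t              ∎
      where q₀ = q (t (suc s)) (t zero)

  annihilate : ∀ {k} → (Fin k → Fin n) → List (Fin k) → Carrierᴹ → Carrierᴹ
  annihilate u rs x = foldl (λ y r → a (u r) y) x rs

  annihilate-cong : ∀ {k} {u u′ : Fin k → Fin n} rs {x y} →
    u ≗ u′ → x ≈ᴹ y → annihilate u rs x ≈ᴹ annihilate u′ rs y
  annihilate-cong []       _    x≈y = x≈y
  annihilate-cong (r ∷ rs) u≗u′ x≈y = annihilate-cong rs u≗u′
    (≈ᴹ-trans (a-cong _ x≈y) (≈ᴹ-reflexive (cong (λ i → a i _) (u≗u′ r))))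

  annihilate-*ₗ : ∀ {k} (u : Fin k → Fin n) rs c x →
    annihilate u rs (c *ₗ x) ≈ᴹ c *ₗ annihilate u rs x
  annihilate-*ₗ u []       c x = ≈ᴹ-refl
  annihilate-*ₗ u (r ∷ rs) c x = ≈ᴹ-trans
    (annihilate-cong rs (λ _ → refl) (a-* (u r) c x)) (annihilate-*ₗ u rs c (a (u r) x))

  -- Step r removes the creator at position π r; alive r is the mask left after r steps.
  module AnnihilationOrder {k} (π : Permutation′ k) (t : Fin k → Fin n)
    (t-injective : Injective _≡_ _≡_ t) where

    deathStep : Fin k → ℕ
    deathStep m = toℕ (π ⟨$⟩ˡ m)

    alive : ℕ → Fin k → Bool
    alive r m = does (r ≤? deathStep m)

    u : Fin k → Fin n
    u r = t (π ⟨$⟩ʳ r)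

    stepWeight : Fin k → Carrier
    stepWeight r = weightBefore (alive (toℕ r)) t (π ⟨$⟩ʳ r)

    a-create-alive : ∀ s {r} → toℕ s ≡ r →
      a (u s) (create (alive r) t) ≈ᴹ stepWeight s *ₗ create (alive (suc r)) t
    a-create-alive s refl =
      a-create (alive (toℕ s)) (alive (suc (toℕ s))) t (π ⟨$⟩ʳ s)
        alive-now dead-next others-unchanged (λ _ _ → t-injective)
      where
      deathStep-π : deathStep (π ⟨$⟩ʳ s) ≡ toℕ s
      deathStep-π = cong toℕ (inverseˡ π)

      alive-now : alive (toℕ s) (π ⟨$⟩ʳ s) ≡ true
      alive-now = ≡.trans (cong (λ d → does (toℕ s ≤? d)) deathStep-π)
        (dec-true (toℕ s ≤? toℕ s) ≤-refl)

      dead-next : alive (suc (toℕ s)) (π ⟨$⟩ʳ s) ≡ false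
      dead-next = ≡.trans (cong (λ d → does (suc (toℕ s) ≤? d)) deathStep-π)
        (dec-false (suc (toℕ s) ≤? toℕ s) (<-irrefl refl))

      others-unchanged : ∀ m → m ≢ π ⟨$⟩ʳ s → alive (suc (toℕ s)) m ≡ alive (toℕ s) m
      others-unchanged m m≢πs = does-suc≤? λ d≡s →
        m≢πs (≡.trans (≡.sym (inverseʳ π)) (cong (π ⟨$⟩ʳ_) (toℕ-injective d≡s)))

    annihilate-from : ∀ {j} (g : Fin j → Fin k) r →
      (∀ i → toℕ (g i) ≡ r + toℕ i) → r + j ≡ k →
      annihilate u (tabulate g) (create (alive r) t) ≈ᴹ ∏ R (stepWeight ∘ g) *ₗ vac
    annihilate-from {zero} g r _ r+0≡k = begin
      create (alive r) t  ≡⟨ create-none t all-dead ⟩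
      vac                 ≈⟨ *ₗ-identityˡ vac ⟨
      1# *ₗ vac           ∎
      where
      all-dead : ∀ m → alive r m ≡ false
      all-dead m = dec-false (r ≤? deathStep m)
        (<⇒≱ (≡.subst (deathStep m ℕ.<_) (≡.trans (≡.sym r+0≡k) (+-identityʳ r)) (toℕ<n _)))
    annihilate-from {suc j} g r g≡r+ r+j≡k = begin
      annihilate u rest (a (u (g zero)) (create (alive r) t))
        ≈⟨ annihilate-cong rest (λ _ → refl) first-step ⟩
      annihilate u rest (stepWeight (g zero) *ₗ create (alive (suc r)) t)
        ≈⟨ annihilate-*ₗ u rest _ _ ⟩
      stepWeight (g zero) *ₗ annihilate u rest (create (alive (suc r)) t)
        ≈⟨ *ₗ-congˡ later-steps ⟩
      stepWeight (g zero) *ₗ (∏ R (stepWeight ∘ g ∘ suc) *ₗ vac)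
        ≈⟨ *ₗ-assoc _ _ vac ⟨
      ∏ R (stepWeight ∘ g) *ₗ vac
        ∎
      where
      rest = tabulate (g ∘ suc)
      first-step = a-create-alive (g zero) (≡.trans (g≡r+ zero) (+-identityʳ r))
      later-steps = annihilate-from (g ∘ suc) (suc r)
        (λ i → ≡.trans (g≡r+ (suc i)) (+-suc r (toℕ i))) (≡.trans (≡.sym (+-suc r j)) r+j≡k)

    bra-annihilate-create : bra (annihilate u (allFin k) (create (λ _ → true) t)) ≈ ∏ R stepWeight
    bra-annihilate-create =
      trans (bra-cong (annihilate-from (λ i → i) 0 (λ _ → refl) refl))
        (trans (bra-* _ vac) (trans (*-congˡ bra-vac) (*-identityʳ _)))
      where open CommutativeRing R using (trans; *-congˡ; *-identityʳ)

    ∏-stepWeight : ∏ R stepWeight ≈ inversionProduct (λ i j → q (u i) (u j)) π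
    ∏-stepWeight = ∏-cong λ r → trans (∏-permute _ π) (∏-cong λ j →
      reflexive (cong (if_then q (u r) (u j) else 1#) (condition r j)))
      where
      open CommutativeRing R using (trans; reflexive)
      condition : ∀ r j → alive (toℕ r) (π ⟨$⟩ʳ j) ∧ does (π ⟨$⟩ʳ j <? π ⟨$⟩ʳ r)
                            ≡ ⌊ r <? j ⌋ ∧ ⌊ π ⟨$⟩ʳ j <? π ⟨$⟩ʳ r ⌋
      condition r j = ≡.trans (cong (λ d → does (toℕ r ≤? toℕ d) ∧ _) (inverseˡ π))
        (does-≤?∧<?≡⌊<?⌋∧⌊<?⌋ r j (π ⟨$⟩ʳ r) (π ⟨$⟩ʳ j) (cong (π ⟨$⟩ʳ_)))

  -- σ ∘ₚ flip τ is τ⁻¹σ: step r removes the creator at position τ⁻¹(σ r), whose label is σ r.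
  vev≈rhsProd : ∀ σ τ → vev σ τ ≈ rhsProd R q σ τ
  vev≈rhsProd σ τ =
    trans (bra-cong (annihilate-cong (allFin n) (≡.sym ∘ u≗σ) (≈ᴹ-reflexive (create-all (τ ⟨$⟩ʳ_) (λ i → i)))))
      (trans bra-annihilate-create
        (trans ∏-stepWeight (inversionProduct-cong (σ ∘ₚ flip τ) λ i j → ≡.cong₂ q (u≗σ i) (u≗σ j))))
    where
    open CommutativeRing R using (trans)
    open AnnihilationOrder (σ ∘ₚ flip τ) (τ ⟨$⟩ʳ_) (Injection.injective (↔⇒↣ τ))
    u≗σ : u ≗ (σ ⟨$⟩ʳ_)
    u≗σ _ = inverseʳ τ

lemma3p3 : ∀ {c ℓ m ℓm} (R : CommutativeRing c ℓ) (M : Module R m ℓm)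
    (n : ℕ) (q : Fin n → Fin n → CommutativeRing.Carrier R)
    (rep : OscRep R M n q) (σ τ : Permutation′ n) →
    CommutativeRing._≈_ R (OscRep.vev rep σ τ) (vₙ R q σ τ)
      × CommutativeRing._≈_ R (vₙ R q σ τ) (rhsProd R q σ τ)
lemma3p3 R M n q rep σ τ = trans (vev≈rhsProd σ τ) (sym (vₙ≈rhsProd q σ τ)) , vₙ≈rhsProd q σ τ
  where
  open CommutativeRing R using (trans; sym)
  open Products R using (vₙ≈rhsProd)
  open Fock rep using (vev≈rhsProd)
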